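{- Let $\mathbf{T}\in\{0,1\}^{n\times\ell}$ be a matrix consisting of $\ell\ge 14$ dirty columns with $\delta(\mathbf{T})=3$. Then, for some permutation of the rows of $\mathbf{T}$, the resulting matrix $\mathbf{T}'$ satisfies $|\mathcal{T}'_3|\ge 5$.
   Context: For rows $u,w\in\{0,1\}^\ell$, $D(u,w)=\{j\in[\ell]:u[j]\ne w[j]\}$ and $d(u,w)=|D(u,w)|$. $\delta(\mathbf{T})=\max_{i\ne i'}d(\mathbf{T}[i],\mathbf{T}[i'])$. A column is dirty if it contains both $0$ and $1$. For a matrix $\mathbf{T}'$ with $n$ rows and $x\in\mathbb{N}$, $\mathcal{T}'_x$ is the set (without duplicates) $\{D(\mathbf{T}'[i],\mathbf{T}'[n]) : i\in[n-1],\ d(\mathbf{T}'[i],\mathbf{T}'[n])=x\}$, where $\mathbf{T}'[i]$ is the $i$-th row. -}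

module Defs where

open import Data.Nat using (ℕ; suc; _≤_)
open import Data.Bool using (Bool; true; false; _xor_)
open import Data.Fin using (Fin; fromℕ; inject₁)
open import Data.Fin.Subset using (Subset; ∣_∣)
open import Data.Fin.Permutation using (Permutation′; _⟨$⟩ʳ_)
open import Data.Vec using (tabulate)
open import Data.List using (List; length)
open import Data.List.Membership.Propositional using (_∈_)
open import Data.List.Relation.Unary.Unique.Propositional using (Unique)
open import Data.Product using (Σ; ∃; ∃-syntax; _×_; _,_)
open import Relation.Binary.PropositionalEquality using (_≡_; _≢_)

Matrix : ℕ → ℕ → Set
Matrix n ℓ = Fin n → Fin ℓ → Bool

Row : ℕ → Set
Row ℓ = Fin ℓ → Bool

D : ∀ {ℓ} → Row ℓ → Row ℓ → Subset ℓ
D u w = tabulate (λ j → u j xor w j)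

d : ∀ {ℓ} → Row ℓ → Row ℓ → ℕ
d u w = ∣ D u w ∣

-- δ(T) = δ₀ : δ₀ is the maximum of d over pairs of distinct rows
-- (an upper bound attained by some pair of distinct rows).
δ≡ : ∀ {n ℓ} → Matrix n ℓ → ℕ → Set
δ≡ T δ₀ =
  (∀ i i' → i ≢ i' → d (T i) (T i') ≤ δ₀)
  × (∃[ i ] ∃[ i' ] (i ≢ i' × d (T i) (T i') ≡ δ₀))

Dirty : ∀ {n ℓ} → Matrix n ℓ → Fin ℓ → Set
Dirty T j = (∃[ i ] T i j ≡ false) × (∃[ i ] T i j ≡ true)

permuteRows : ∀ {n ℓ} → Permutation′ n → Matrix n ℓ → Matrix n ℓ
permuteRows π T i = T (π ⟨$⟩ʳ i)

-- S ∈ 𝒯'_x  (T' has m+1 rows, the last one is fromℕ m; i ranges over [n-1])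
In𝒯 : ∀ {m ℓ} → Matrix (suc m) ℓ → ℕ → Subset ℓ → Set
In𝒯 {m} T' x S =
  ∃[ i ] (d (T' (inject₁ i)) (T' (fromℕ m)) ≡ x
          × D (T' (inject₁ i)) (T' (fromℕ m)) ≡ S)

Card𝒯≥ : ∀ {m ℓ} → Matrix (suc m) ℓ → ℕ → ℕ → Set
Card𝒯≥ {ℓ = ℓ} T' x k =
  Σ (List (Subset ℓ)) λ Ss →
    Unique Ss × k ≤ length Ss × (∀ {S} → S ∈ Ss → In𝒯 T' x S)

module Submission where

-- Let u = T[i], v = T[i'] be two rows at distance d(u,v) = 3; they agree
-- in a set L of at least ℓ - 3 ≥ 11 columns.  Every column j of L is dirty, so some row
-- w_j differs from u (hence also from v) in column j.  For Hamming distances one has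
--     d(w,u) + d(w,v) = d(u,v) + 2·|{k : w[k] ≠ u[k] = v[k]}|,
-- and as d(w_j,u), d(w_j,v) ≤ 3 the excess set on the right is exactly {j}.  Hence
--   (1) d(w_j,u) = 3 or d(w_j,v) = 3, and
--   (2) w_j agrees with u on L ∖ {j}, so the sets D(w_j,u) (and D(w_j,v)) are pairwise
--       distinct for j ∈ L, as j ∈ D(w_j,·) but j ∉ D(w_j',·) for j' ≠ j.
-- By (1) and |L| ≥ 11, at least 5 columns j have d(w_j,u) = 3, or at least 5 have
-- d(w_j,v) = 3.  Swapping that reference row into the last position yields |𝒯'_3| ≥ 5.

open import Defs
open import Data.Nat using (ℕ; suc; _≤_)
open import Data.Fin.Permutation using (Permutation′)
open import Data.Product using (∃-syntax)

open import Algebra.Properties.CommutativeSemigroup using (interchange)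
open import Data.Bool using (Bool; true; false; _xor_; _∧_; not)
open import Data.Bool.Properties using () renaming (_≟_ to _≟ᵇ_)
open import Data.Fin using (Fin; zero; suc; fromℕ; inject₁; lower₁; toℕ)
open import Data.Fin.Permutation using (transpose; _⟨$⟩ʳ_; _⟨$⟩ˡ_; inverseʳ)
open import Data.Fin.Properties using (_≟_; toℕ-fromℕ; toℕ-injective; inject₁-lower₁)
open import Data.Fin.Subset using (Subset; ∣_∣) renaming (_∈_ to _∈ˢ_)
open import Data.Fin.Subset.Properties using (x∈p⇒∣p-x∣<∣p∣; x∈p∧x≢y⇒x∈p-y)
open import Data.List as List using (List; []; _∷_; length; map; filter; allFin)
open import Data.List.Properties using (length-map; length-tabulate)
open import Data.List.Membership.Propositional using (_∈_)
open import Data.List.Membership.Propositional.Properties using (∈-filter⁻; ∈-map⁻)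
open import Data.List.Relation.Unary.All as All using ()
open import Data.List.Relation.Unary.All.Properties as All using ()
open import Data.List.Relation.Unary.Any using (here; there)
open import Data.List.Relation.Unary.AllPairs using ([]; _∷_)
open import Data.List.Relation.Unary.Unique.Propositional using (Unique)
open import Data.List.Relation.Unary.Unique.Propositional.Properties using (filter⁺; allFin⁺)
open import Data.Nat using (_+_; _*_; _<_; z≤n; s≤s)
open import Data.Nat.Properties
  using (+-commutativeSemigroup; *-distribˡ-+; +-suc; ≤-trans; <-irrefl; +-mono-≤;
         +-cancelʳ-≤; +-monoʳ-≤; *-monoʳ-≤; m≤m+n; ≮⇒≥; _<?_)
  renaming (_≟_ to _≟ⁿ_)
open import Data.Product using (_×_; _,_; proj₁; proj₂)
open import Data.Sum using (_⊎_; inj₁; inj₂; [_,_]′)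
open import Data.Vec using (_∷_; tabulate)
open import Data.Vec.Properties using (lookup∘tabulate; lookup⇒[]=; []=⇒lookup; tabulate-cong)
open import Function using (_∘_)
open import Relation.Binary.PropositionalEquality
  using (_≡_; _≢_; refl; sym; trans; cong; cong₂; subst; module ≡-Reasoning)
open import Relation.Nullary using (does; yes; no; contradiction; ¬?)
open import Relation.Nullary.Decidable using (decidable-stable; dec-true)
open import Relation.Unary using (Pred; Decidable)
open import Relation.Unary.Properties using (∁?)

bit : Bool → ℕ
bit true  = 1
bit false = 0

∣∷∣ : ∀ {ℓ} b (p : Subset ℓ) → ∣ b ∷ p ∣ ≡ bit b + ∣ p ∣
∣∷∣ true  p = refl
∣∷∣ false p = refl

count-linear : ∀ {ℓ} (f g h e : Fin ℓ → Bool) →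
               (∀ k → bit (f k) + bit (g k) ≡ bit (h k) + 2 * bit (e k)) →
               ∣ tabulate f ∣ + ∣ tabulate g ∣ ≡ ∣ tabulate h ∣ + 2 * ∣ tabulate e ∣
count-linear {ℕ.zero}  f g h e pointwise = refl
count-linear {ℕ.suc ℓ} f g h e pointwise = begin
  ∣ f₀ ∷ fs ∣ + ∣ g₀ ∷ gs ∣                      ≡⟨ cong₂ _+_ (∣∷∣ f₀ fs) (∣∷∣ g₀ gs) ⟩
  (bit f₀ + ∣ fs ∣) + (bit g₀ + ∣ gs ∣)          ≡⟨ swap (bit f₀) (∣ fs ∣) (bit g₀) (∣ gs ∣) ⟩
  (bit f₀ + bit g₀) + (∣ fs ∣ + ∣ gs ∣)
    ≡⟨ cong₂ _+_ (pointwise zero) (count-linear _ _ _ _ (pointwise ∘ suc)) ⟩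
  (bit h₀ + 2 * bit e₀) + (∣ hs ∣ + 2 * ∣ es ∣)  ≡⟨ swap (bit h₀) (2 * bit e₀) (∣ hs ∣) (2 * ∣ es ∣) ⟩
  (bit h₀ + ∣ hs ∣) + (2 * bit e₀ + 2 * ∣ es ∣)
    ≡⟨ cong₂ _+_ (sym (∣∷∣ h₀ hs)) (sym (*-distribˡ-+ 2 (bit e₀) (∣ es ∣))) ⟩
  ∣ h₀ ∷ hs ∣ + 2 * (bit e₀ + ∣ es ∣)            ≡⟨ cong (λ n → ∣ h₀ ∷ hs ∣ + 2 * n) (sym (∣∷∣ e₀ es)) ⟩
  ∣ h₀ ∷ hs ∣ + 2 * ∣ e₀ ∷ es ∣                  ∎
  where
  open ≡-Reasoning
  swap : ∀ a b c e → (a + b) + (c + e) ≡ (a + c) + (b + e)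
  swap = interchange +-commutativeSemigroup
  f₀ g₀ h₀ e₀ : Bool
  f₀ = f zero ; g₀ = g zero ; h₀ = h zero ; e₀ = e zero
  fs gs hs es : Subset ℓ
  fs = tabulate (f ∘ suc) ; gs = tabulate (g ∘ suc)
  hs = tabulate (h ∘ suc) ; es = tabulate (e ∘ suc)

∈tabulate⁺ : ∀ {ℓ} {f : Fin ℓ → Bool} {j} → f j ≡ true → j ∈ˢ tabulate f
∈tabulate⁺ {f = f} {j} fj≡true = lookup⇒[]= j (tabulate f) (trans (lookup∘tabulate f j) fj≡true)

∈tabulate⁻ : ∀ {ℓ} {f : Fin ℓ → Bool} {j} → j ∈ˢ tabulate f → f j ≡ true
∈tabulate⁻ {f = f} {j} j∈ = trans (sym (lookup∘tabulate f j)) ([]=⇒lookup j∈)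

one-member : ∀ {ℓ} {p : Subset ℓ} {x} → x ∈ˢ p → 1 ≤ ∣ p ∣
one-member x∈p = ≤-trans (s≤s z≤n) (x∈p⇒∣p-x∣<∣p∣ x∈p)

two-members : ∀ {ℓ} {p : Subset ℓ} {x y} → x ∈ˢ p → y ∈ˢ p → x ≢ y → 2 ≤ ∣ p ∣
two-members x∈p y∈p x≢y =
  ≤-trans (s≤s (one-member (x∈p∧x≢y⇒x∈p-y x∈p x≢y))) (x∈p⇒∣p-x∣<∣p∣ y∈p)

length-filter-tabulate : ∀ {a p} {A : Set a} {P : Pred A p} (P? : Decidable P)
                         {n} (g : Fin n → A) →
                         length (filter P? (List.tabulate g))
                         ≡ ∣ tabulate (λ k → does (P? (g k))) ∣
length-filter-tabulate P? {ℕ.zero}  g = refl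
length-filter-tabulate P? {ℕ.suc n} g with does (P? (g zero))
... | true  = cong suc (length-filter-tabulate P? (g ∘ suc))
... | false = length-filter-tabulate P? (g ∘ suc)

length-filter-split : ∀ {a p} {A : Set a} {P : Pred A p} (P? : Decidable P)
                      (xs : List A) →
                      length (filter P? xs) + length (filter (∁? P?) xs) ≡ length xs
length-filter-split P? []       = refl
length-filter-split P? (x ∷ xs) with does (P? x)
... | true  = cong suc (length-filter-split P? xs)
... | false = trans (+-suc _ _) (cong suc (length-filter-split P? xs))

<-+-split : ∀ {a b x y} → a + b < x + y → a < x ⊎ b < y
<-+-split {a} {b} {x} {y} a+b<x+y with a <? x | b <? y
... | yes a<x | _       = inj₁ a<x
... | no _    | yes b<y = inj₂ b<y
... | no a≮x  | no b≮y  =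
  contradiction (≤-trans a+b<x+y (+-mono-≤ (≮⇒≥ a≮x) (≮⇒≥ b≮y))) (<-irrefl refl)

≢⇒xor : ∀ {a b} → a ≢ b → a xor b ≡ true
≢⇒xor {true}  {true}  a≢b = contradiction refl a≢b
≢⇒xor {true}  {false} _   = refl
≢⇒xor {false} {true}  _   = refl
≢⇒xor {false} {false} a≢b = contradiction refl a≢b

xor⇒≢ : ∀ {a b} → a xor b ≡ true → a ≢ b
xor⇒≢ {true}  {true}  ()
xor⇒≢ {false} {false} ()
xor⇒≢ {true}  {false} _ ()
xor⇒≢ {false} {true}  _ ()

∈D⁺ : ∀ {ℓ} {u w : Row ℓ} {j} → u j ≢ w j → j ∈ˢ D u w
∈D⁺ uj≢wj = ∈tabulate⁺ (≢⇒xor uj≢wj)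

∈D⁻ : ∀ {ℓ} {u w : Row ℓ} {j} → j ∈ˢ D u w → u j ≢ w j
∈D⁻ j∈ = xor⇒≢ (∈tabulate⁻ j∈)

excess : ∀ {ℓ} → Row ℓ → Row ℓ → Row ℓ → Subset ℓ
excess w u v = tabulate (λ k → (w k xor u k) ∧ not (u k xor v k))

∈excess⁺ : ∀ {ℓ} {w u v : Row ℓ} {k} → w k ≢ u k → u k ≡ v k → k ∈ˢ excess w u v
∈excess⁺ {w = w} {u} {v} {k} wk≢uk uk≡vk =
  ∈tabulate⁺ (deviation-bit (w k) (u k) (v k) wk≢uk uk≡vk)
  where
  deviation-bit : ∀ a b c → a ≢ b → b ≡ c → (a xor b) ∧ not (b xor c) ≡ true
  deviation-bit true  false false _   refl = refl
  deviation-bit false true  true  _   refl = refl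
  deviation-bit true  true  _     a≢b _    = contradiction refl a≢b
  deviation-bit false false _     a≢b _    = contradiction refl a≢b

excess-identity : ∀ {ℓ} (u v w : Row ℓ) → d w u + d w v ≡ d u v + 2 * ∣ excess w u v ∣
excess-identity u v w = count-linear _ _ _ _ (λ k → column (w k) (u k) (v k))
  where
  column : ∀ a b c → bit (a xor b) + bit (a xor c)
                     ≡ bit (b xor c) + 2 * bit ((a xor b) ∧ not (b xor c))
  column true  true  true  = refl
  column true  true  false = refl
  column true  false true  = refl
  column true  false false = refl
  column false true  true  = refl
  column false true  false = refl
  column false false true  = refl
  column false false false = refl

five-split : ∀ {x y} → x ≤ 3 → y ≤ 3 → x + y ≡ 5 → x ≡ 3 ⊎ y ≡ 3
five-split {3} _ _ _ = inj₁ refl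
five-split {2} _ _ refl = inj₂ refl
five-split {1} _ (s≤s (s≤s (s≤s ()))) refl
five-split {0} _ (s≤s (s≤s (s≤s ()))) refl
five-split {suc (suc (suc (suc _)))} (s≤s (s≤s (s≤s ()))) _ _

-- Two distances ≤ 3 summing to 3 + 2e with e ≥ 1 force e = 1 (as 3 + 2·2 > 6), and
-- then one of them is 3.
deviation-arith : ∀ {x y e} → x ≤ 3 → y ≤ 3 → x + y ≡ 3 + 2 * e → 1 ≤ e →
                  (x ≡ 3 ⊎ y ≡ 3) × e ≡ 1
deviation-arith {e = 1} x≤3 y≤3 x+y≡5 _ = five-split x≤3 y≤3 x+y≡5 , refl
deviation-arith {x} {y} {suc (suc e)} x≤3 y≤3 x+y≡3+2e _ =
  contradiction (≤-trans seven≤3+2e (subst (_≤ 6) x+y≡3+2e (+-mono-≤ x≤3 y≤3))) (<-irrefl refl)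
  where
  seven≤3+2e : 7 ≤ 3 + 2 * suc (suc e)
  seven≤3+2e = +-monoʳ-≤ 3 (*-monoʳ-≤ 2 (s≤s (s≤s z≤n)))

single-deviation : ∀ {ℓ} (u v w : Row ℓ) {j} →
                   d u v ≡ 3 → d w u ≤ 3 → d w v ≤ 3 → j ∈ˢ excess w u v →
                   (d w u ≡ 3 ⊎ d w v ≡ 3) × (∀ {k} → k ∈ˢ excess w u v → k ≡ j)
single-deviation u v w {j} duv≡3 dwu≤3 dwv≤3 j∈ = proj₁ arith , only-j
  where
  arith : (d w u ≡ 3 ⊎ d w v ≡ 3) × ∣ excess w u v ∣ ≡ 1
  arith = deviation-arith dwu≤3 dwv≤3
            (trans (excess-identity u v w) (cong (_+ 2 * ∣ excess w u v ∣) duv≡3))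
            (one-member j∈)
  only-j : ∀ {k} → k ∈ˢ excess w u v → k ≡ j
  only-j {k} k∈ = decidable-stable (k ≟ j) λ k≢j →
    <-irrefl refl (subst (2 ≤_) (proj₂ arith) (two-members k∈ j∈ k≢j))

agreeing : ∀ {ℓ} → Row ℓ → Row ℓ → List (Fin ℓ)
agreeing {ℓ} u v = filter (λ k → u k ≟ᵇ v k) (allFin ℓ)

agreeing-length : ∀ {ℓ} (u v : Row ℓ) → length (agreeing u v) + d u v ≡ ℓ
agreeing-length {ℓ} u v = begin
  length (agreeing u v) + d u v
    ≡⟨ cong (length (agreeing u v) +_) disagreeing ⟩
  length (agreeing u v) + length (filter (∁? agree?) (allFin ℓ))
    ≡⟨ length-filter-split agree? (allFin ℓ) ⟩
  length (allFin ℓ)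
    ≡⟨ length-tabulate (λ k → k) ⟩
  ℓ ∎
  where
  open ≡-Reasoning
  agree? : Decidable (λ k → u k ≡ v k)
  agree? k = u k ≟ᵇ v k
  disagree-xor : ∀ a b → does (¬? (a ≟ᵇ b)) ≡ a xor b
  disagree-xor true  true  = refl
  disagree-xor true  false = refl
  disagree-xor false true  = refl
  disagree-xor false false = refl
  disagreeing : d u v ≡ length (filter (∁? agree?) (allFin ℓ))
  disagreeing = sym (trans (length-filter-tabulate (∁? agree?) (λ k → k))
                           (cong ∣_∣ (tabulate-cong (λ k → disagree-xor (u k) (v k)))))

map⁺-on : ∀ {A B : Set} (f : A → B) {xs : List A} → Unique xs →
          (∀ {x y} → x ∈ xs → y ∈ xs → f x ≡ f y → x ≡ y) → Unique (map f xs)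
map⁺-on f {[]}     []                _   = []
map⁺-on f {x ∷ xs} (x∉xs ∷ unique-xs) inj =
  All.map⁺ (All.tabulate (λ y∈ fx≡fy → All.lookup x∉xs y∈ (inj (here refl) (there y∈) fx≡fy)))
  ∷ map⁺-on f unique-xs (λ x∈ y∈ → inj (there x∈) (there y∈))

dirty-witness : ∀ {n ℓ} {T : Matrix n ℓ} {j} → Dirty T j → ∀ b → ∃[ a ] T a j ≢ b
dirty-witness (_ , (a , Taj≡true)) false =
  a , λ Taj≡false → contradiction (trans (sym Taj≡true) Taj≡false) λ ()
dirty-witness ((a , Taj≡false) , _) true =
  a , λ Taj≡true → contradiction (trans (sym Taj≡false) Taj≡true) λ ()

transpose-last : ∀ {m} (r : Fin (suc m)) → transpose (fromℕ m) r ⟨$⟩ʳ fromℕ m ≡ r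
transpose-last {m} r rewrite dec-true (fromℕ m ≟ fromℕ m) refl = refl

non-last-preimage : ∀ {m} (π : Permutation′ (suc m)) {a} → a ≢ π ⟨$⟩ʳ fromℕ m →
                    ∃[ k ] π ⟨$⟩ʳ inject₁ k ≡ a
non-last-preimage {m} π {a} a≢last =
  lower₁ b m≢b , trans (cong (π ⟨$⟩ʳ_) (inject₁-lower₁ b m≢b)) (inverseʳ π)
  where
  b : Fin (suc m)
  b = π ⟨$⟩ˡ a
  m≢b : m ≢ toℕ b
  m≢b m≡b = a≢last (trans (sym (inverseʳ π))
                          (cong (π ⟨$⟩ʳ_) (toℕ-injective (trans (sym m≡b) (sym (toℕ-fromℕ m))))))

card𝒯-by-moving-last : ∀ {m ℓ x k} {J : Set} (T : Matrix (suc m) ℓ) (r : Fin (suc m))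
                       (row : J → Fin (suc m)) (js : List J) →
                       Unique (map (λ j → D (T (row j)) (T r)) js) → k ≤ length js →
                       (∀ {j} → j ∈ js → row j ≢ r × d (T (row j)) (T r) ≡ x) →
                       ∃[ π ] Card𝒯≥ (permuteRows π T) x k
card𝒯-by-moving-last {m} {ℓ} {x} {k} {J} T r row js unique k≤ at-distance =
  π , map difference js , unique , subst (k ≤_) (sym (length-map difference js)) k≤ , member
  where
  π : Permutation′ (suc m)
  π = transpose (fromℕ m) r
  difference : J → Subset ℓ
  difference j = D (T (row j)) (T r)
  member : ∀ {S} → S ∈ map difference js → In𝒯 (permuteRows π T) x S
  member S∈ with ∈-map⁻ difference S∈
  ... | j , j∈ , refl
    with non-last-preimage π (subst (row j ≢_) (sym (transpose-last r)) (proj₁ (at-distance j∈)))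
  ... | i , πi≡row =
    i , trans (cong₂ d row-i last-r) (proj₂ (at-distance j∈)) , cong₂ D row-i last-r
    where
    row-i : T (π ⟨$⟩ʳ inject₁ i) ≡ T (row j)
    row-i = cong T πi≡row
    last-r : T (π ⟨$⟩ʳ fromℕ m) ≡ T r
    last-r = cong T (transpose-last r)

module WitnessRows {m ℓ} (T : Matrix (suc m) ℓ) (dirty : ∀ j → Dirty T j)
                   (close : ∀ a b → a ≢ b → d (T a) (T b) ≤ 3)
                   {i i' : Fin (suc m)} (far : d (T i) (T i') ≡ 3) where

  u v : Row ℓ
  u = T i
  v = T i'

  witness : Fin ℓ → Fin (suc m)
  witness j = proj₁ (dirty-witness {T = T} (dirty j) (u j))

  w : Fin ℓ → Row ℓ
  w j = T (witness j)

  witness-deviates : ∀ j → w j j ≢ u j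
  witness-deviates j = proj₂ (dirty-witness {T = T} (dirty j) (u j))

  L : List (Fin ℓ)
  L = agreeing u v

  L-agrees : ∀ {j} → j ∈ L → u j ≡ v j
  L-agrees j∈L = proj₂ (∈-filter⁻ (λ k → u k ≟ᵇ v k) {xs = allFin ℓ} j∈L)

  L-length : 14 ≤ ℓ → 11 ≤ length L
  L-length 14≤ℓ = +-cancelʳ-≤ 3 11 (length L)
    (subst (14 ≤_) (sym (trans (cong (length L +_) (sym far)) (agreeing-length u v))) 14≤ℓ)

  L-unique : Unique L
  L-unique = filter⁺ (λ k → u k ≟ᵇ v k) (allFin⁺ ℓ)

  -- A witness row is neither u nor (for j ∈ L) v, so it lies within distance 3 of both.
  witness≢i : ∀ j → witness j ≢ i
  witness≢i j eq = witness-deviates j (cong (λ a → T a j) eq)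

  witness≢i' : ∀ {j} → j ∈ L → witness j ≢ i'
  witness≢i' {j} j∈L eq =
    witness-deviates j (trans (cong (λ a → T a j) eq) (sym (L-agrees j∈L)))

  deviation : ∀ {j} → j ∈ L →
              (d (w j) u ≡ 3 ⊎ d (w j) v ≡ 3) × (∀ {k} → k ∈ˢ excess (w j) u v → k ≡ j)
  deviation {j} j∈L =
    single-deviation u v (w j) far (close _ _ (witness≢i j)) (close _ _ (witness≢i' j∈L))
                     (∈excess⁺ {w = w j} {u} {v} (witness-deviates j) (L-agrees j∈L))

  witness-agrees : ∀ {j j'} → j ∈ L → j' ∈ L → j ≢ j' → w j' j ≡ u j
  witness-agrees j∈L j'∈L j≢j' = decidable-stable (_ ≟ᵇ _) λ w≢u →
    j≢j' (proj₂ (deviation j'∈L) (∈excess⁺ {w = w _} {u} {v} w≢u (L-agrees j∈L)))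

  -- For a reference row r agreeing with u on L, the sets D(w j, r) are pairwise distinct:
  -- column j lies in D(w j, r) but not in D(w j', r) for j' ≠ j.
  distinct-differences : (r : Row ℓ) → (∀ {j} → j ∈ L → r j ≡ u j) →
                         ∀ {js} → Unique js → (∀ {j} → j ∈ js → j ∈ L) →
                         Unique (map (λ j → D (w j) r) js)
  distinct-differences r r≡u unique js⊆L =
    map⁺-on _ unique λ j∈ j'∈ → separated (js⊆L j∈) (js⊆L j'∈)
    where
    own-column : ∀ {j} → j ∈ L → j ∈ˢ D (w j) r
    own-column {j} j∈L = ∈D⁺ {u = w j} (subst (w j j ≢_) (sym (r≡u j∈L)) (witness-deviates j))
    separated : ∀ {j j'} → j ∈ L → j' ∈ L → D (w j) r ≡ D (w j') r → j ≡ j'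
    separated {j} {j'} j∈L j'∈L same = decidable-stable (j ≟ j') λ j≢j' →
      ∈D⁻ {u = w j'} (subst (j ∈ˢ_) same (own-column j∈L))
          (trans (witness-agrees j∈L j'∈L j≢j') (sym (r≡u j∈L)))

  near-u? : Decidable (λ j → d (w j) u ≡ 3)
  near-u? j = d (w j) u ≟ⁿ 3

  near-u near-v : List (Fin ℓ)
  near-u = filter near-u? L
  near-v = filter (∁? near-u?) L

  large-class : 14 ≤ ℓ → 5 ≤ length near-u ⊎ 5 ≤ length near-v
  large-class 14≤ℓ = <-+-split (subst (9 ≤_) (sym (length-filter-split near-u? L))
                                     (≤-trans (m≤m+n 9 2) (L-length 14≤ℓ)))

  near-u-unique : Unique near-u
  near-u-unique = filter⁺ near-u? {L} L-unique

  near-v-unique : Unique near-v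
  near-v-unique = filter⁺ (∁? near-u?) {L} L-unique

  near-u⊆L : ∀ {j} → j ∈ near-u → j ∈ L
  near-u⊆L = proj₁ ∘ ∈-filter⁻ near-u? {xs = L}

  near-v⊆L : ∀ {j} → j ∈ near-v → j ∈ L
  near-v⊆L = proj₁ ∘ ∈-filter⁻ (∁? near-u?) {xs = L}

  near-u-distance : ∀ {j} → j ∈ near-u → d (w j) u ≡ 3
  near-u-distance = proj₂ ∘ ∈-filter⁻ near-u? {xs = L}

  near-v-distance : ∀ {j} → j ∈ near-v → d (w j) v ≡ 3
  near-v-distance j∈ with ∈-filter⁻ (∁? near-u?) {xs = L} j∈
  ... | j∈L , not-near-u with proj₁ (deviation j∈L)
  ...   | inj₁ near-u = contradiction near-u not-near-u
  ...   | inj₂ near-v = near-v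

  from-class : (r : Fin (suc m)) → (∀ {j} → j ∈ L → T r j ≡ u j) →
               (js : List (Fin ℓ)) → Unique js → (∀ {j} → j ∈ js → j ∈ L) →
               (∀ {j} → j ∈ js → witness j ≢ r × d (w j) (T r) ≡ 3) → 5 ≤ length js →
               ∃[ π ] Card𝒯≥ (permuteRows π T) 3 5
  from-class r r≡u js unique js⊆L at-distance 5≤ =
    card𝒯-by-moving-last T r witness js (distinct-differences (T r) r≡u unique js⊆L)
                         5≤ at-distance

lemma15 : ∀ (m ℓ : ℕ) (T : Matrix (suc m) ℓ) → 14 ≤ ℓ → (∀ j → Dirty T j) → δ≡ T 3 →
    ∃[ π ] Card𝒯≥ (permuteRows π T) 3 5
lemma15 m ℓ T 14≤ℓ dirty (close , i , i' , _ , far) = [ via-u , via-v ]′ (large-class 14≤ℓ)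
  where
  open WitnessRows T dirty close far
  via-u : 5 ≤ length near-u → ∃[ π ] Card𝒯≥ (permuteRows π T) 3 5
  via-u = from-class i (λ _ → refl) near-u near-u-unique near-u⊆L
                     (λ j∈ → witness≢i _ , near-u-distance j∈)
  via-v : 5 ≤ length near-v → ∃[ π ] Card𝒯≥ (permuteRows π T) 3 5
  via-v = from-class i' (sym ∘ L-agrees) near-v near-v-unique near-v⊆L
                     (λ j∈ → witness≢i' (near-v⊆L j∈) , near-v-distance j∈)
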